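{- Let $n\ge2$ and let $\Delta^+=\{e_i-e_j\mid 1\le i<j\le n\}$ be the positive roots of type $A_{n-1}$. There exists a bijection from the set of all quasi-antichains of $\Delta^+$ to the set of all set partitions of $[n]=\{1,\dots,n\}$ which sends every quasi-antichain of cardinality $n-k$ to a partition of $[n]$ with exactly $k$ blocks.
   Context: A subset $S\subseteq\Delta^+$ is a quasi-antichain if for any two distinct $\alpha,\beta\in S$, $\alpha-\beta$ is not a nonzero integer multiple of any root (roots being $\pm(e_i-e_j)$, $i\ne j$). A partition of $[n]$ into $k$ blocks is a set $\{B_1,\dots,B_k\}$ of nonempty pairwise disjoint subsets with union $[n]$. -}

module Defs where

open import Level using (0ℓ)
open import Data.Nat using (ℕ)
open import Data.Integer using (ℤ; _-_; _*_; 0ℤ; 1ℤ)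
open import Data.Fin using (Fin; _<_; _≟_)
open import Data.Fin.Subset using (Subset; Nonempty; Empty; _∩_) renaming (_∈_ to _∈ₛ_)
open import Data.Product using (Σ; _×_; _,_; proj₁; proj₂; ∃; ∃-syntax)
open import Data.List using (List; length)
open import Data.List.Membership.Propositional using (_∈_)
open import Data.List.Relation.Unary.All using (All)
open import Data.List.Relation.Unary.Unique.Propositional using (Unique)
open import Relation.Binary.PropositionalEquality using (_≡_; _≢_)
open import Relation.Binary.Bundles using (Setoid)
open import Relation.Binary.Structures using (IsEquivalence)
open import Relation.Nullary using (¬_; yes; no)
open import Function using (id; _∘_)

e : ∀ {n} → Fin n → Fin n → ℤ
e i x with i ≟ x
... | yes _ = 1ℤ
... | no  _ = 0ℤ

eDiff : ∀ {n} → Fin n → Fin n → Fin n → ℤ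
eDiff i j x = e i x - e j x

-- a positive root e_i - e_j (i < j) is represented by the pair (i , j)
IsPositive : ∀ {n} → Fin n × Fin n → Set
IsPositive (i , j) = i < j

rootVec : ∀ {n} → Fin n × Fin n → Fin n → ℤ
rootVec (i , j) = eDiff i j

-- v is a nonzero integer multiple of some root ±(e_a - e_b), a ≠ b
-- (the sign ± is absorbed by allowing both orders (a , b)).
IsNonzeroMultipleOfRoot : ∀ {n} → (Fin n → ℤ) → Set
IsNonzeroMultipleOfRoot {n} v =
  ∃[ c ] (c ≢ 0ℤ × ∃[ a ] ∃[ b ] (a ≢ b × (∀ x → v x ≡ c * eDiff a b x)))

IsQuasiAntichain : ∀ {n} → List (Fin n × Fin n) → Set
IsQuasiAntichain {n} S =
  ∀ {α β} → α ∈ S → β ∈ S → α ≢ β →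
    ¬ IsNonzeroMultipleOfRoot (λ x → rootVec α x - rootVec β x)

-- Finite sets as duplicate-free lists, with extensional set equality.

SameElems : ∀ {A : Set} → List A → List A → Set
SameElems xs ys = ∀ x → (x ∈ xs → x ∈ ys) × (x ∈ ys → x ∈ xs)

QuasiAntichain : ℕ → Set
QuasiAntichain n =
  Σ (List (Fin n × Fin n)) λ S → Unique S × All IsPositive S × IsQuasiAntichain S

card : ∀ {n} → QuasiAntichain n → ℕ
card S = length (proj₁ S)

IsSetPartition : ∀ {n} → List (Subset n) → Set
IsSetPartition {n} bs =
  Unique bs × All Nonempty bs
  × (∀ {B B'} → B ∈ bs → B' ∈ bs → B ≢ B' → Empty (B ∩ B'))
  × (∀ (x : Fin n) → ∃[ B ] (B ∈ bs × x ∈ₛ B))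

SetPartition : ℕ → Set
SetPartition n = Σ (List (Subset n)) IsSetPartition

blocks : ∀ {n} → SetPartition n → ℕ
blocks P = length (proj₁ P)

private
  sameElems-equiv : ∀ {A : Set} {P : List A → Set} →
    IsEquivalence {A = Σ (List A) P} (λ s t → SameElems (proj₁ s) (proj₁ t))
  sameElems-equiv = record
    { refl  = λ x → id , id
    ; sym   = λ p x → proj₂ (p x) , proj₁ (p x)
    ; trans = λ p q x → proj₁ (q x) ∘ proj₁ (p x) , proj₂ (p x) ∘ proj₂ (q x)
    }

QuasiAntichainSetoid : ℕ → Setoid 0ℓ 0ℓ
QuasiAntichainSetoid n = record
  { Carrier = QuasiAntichain n
  ; _≈_ = λ s t → SameElems (proj₁ s) (proj₁ t)
  ; isEquivalence = sameElems-equiv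
  }

SetPartitionSetoid : ℕ → Setoid 0ℓ 0ℓ
SetPartitionSetoid n = record
  { Carrier = SetPartition n
  ; _≈_ = λ s t → SameElems (proj₁ s) (proj₁ t)
  ; isEquivalence = sameElems-equiv
  }

module Submission where

-- Read a positive root e_i - e_j (i < j) as an arc i → j on [n].  Two distinct
-- positive roots differ by a multiple of a root exactly when they share their
-- source or their target (otherwise their difference has four nonzero
-- coordinates).  So a quasi-antichain is precisely a set of increasing arcs in
-- which every vertex has at most one outgoing and at most one incoming arc: a
-- disjoint union of increasing chains.  The chains starting at the vertices
-- without incoming arc form a set partition, and since sources and targets
-- split [n], it has n - #arcs blocks.  Conversely a partition gives the arcs
-- joining consecutive elements of each block, whose chains are the blocks.

open import Defs
open import Data.Nat as ℕ using (ℕ; zero; suc; z≤n; s≤s; _+_; _∸_; _≤_)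
import Data.Nat.Properties as ℕP
open import Data.Fin as F using (Fin; toℕ)
import Data.Fin.Properties as FP
open import Data.Fin.Subset using (Subset; _∩_; Empty; Nonempty) renaming (_∈_ to _∈ₛ_)
import Data.Fin.Subset.Properties as SubsetP
import Data.Vec as Vec
import Data.Vec.Properties as VecP
import Data.Bool.Properties as BoolP
open import Data.Integer using (ℤ; _-_; _*_; 0ℤ; 1ℤ)
import Data.Integer.Properties as ℤP
open import Data.Integer.Solver using (module +-*-Solver)
open import Data.Product using (Σ; _×_; _,_; proj₁; proj₂; ∃-syntax)
import Data.Product.Properties as ProductP
open import Data.Sum using (_⊎_; inj₁; inj₂)
open import Data.Empty using (⊥-elim)
open import Relation.Nullary using (¬_; Dec; yes; no; does)
open import Relation.Nullary.Decidable using (¬?; _×-dec_; _→-dec_; dec-true; isYes≗does; toWitness; map′)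
open import Relation.Binary.PropositionalEquality
open import Relation.Binary.Definitions using (tri<; tri≈; tri>)
import Relation.Binary.Reasoning.Setoid as SetoidReasoning
open import Relation.Binary.Construct.Closure.ReflexiveTransitive
  using (Star; ε; _◅_; _◅◅_; gmap; reverse)
open import Data.List using (List; []; _∷_; _++_; length; map; filter; allFin; cartesianProduct)
open import Data.List.Properties using (length-map; length-++; length-tabulate; map-cong; filter-≐)
open import Data.List.Membership.Propositional using (_∈_; find; lose)
open import Data.List.Membership.Propositional.Properties
  using (∈-map⁺; ∈-map⁻; ∈-filter⁺; ∈-filter⁻; ∈-allFin; ∈-cartesianProduct⁺; ∈-∃++; ∈-++⁺ˡ; ∈-++⁺ʳ; ∈-++⁻)
import Data.List.Membership.DecPropositional as DecMembership
open import Data.List.Relation.Unary.All as All using (All)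
open import Data.List.Relation.Unary.Any as Any using (here; there)
open import Data.List.Relation.Unary.Unique.Propositional using (Unique)
open import Data.List.Relation.Unary.AllPairs using (_∷_)
import Data.List.Relation.Unary.Unique.Propositional.Properties as UniqueP
open import Function using (flip; _∘_)
open import Function.Bundles using (Bijection; Equivalence)

subsetOf : ∀ {n} {P : Fin n → Set} → (∀ y → Dec (P y)) → Subset n
subsetOf P? = Vec.tabulate (λ y → does (P? y))

∈-subsetOf⁻ : ∀ {n} {P : Fin n → Set} (P? : ∀ y → Dec (P y)) {y} → y ∈ₛ subsetOf P? → P y
∈-subsetOf⁻ P? {y} y∈ = toWitness {a? = P? y} (Equivalence.from BoolP.T-≡
  (trans (isYes≗does (P? y)) (trans (sym (VecP.lookup∘tabulate (λ y → does (P? y)) y)) (VecP.[]=⇒lookup y∈))))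

∈-subsetOf⁺ : ∀ {n} {P : Fin n → Set} (P? : ∀ y → Dec (P y)) {y} → P y → y ∈ₛ subsetOf P?
∈-subsetOf⁺ P? {y} p =
  VecP.lookup⇒[]= y _ (trans (VecP.lookup∘tabulate (λ y → does (P? y)) y) (dec-true (P? y) p))

least : ∀ {n} {Q : Fin n → Set} → (∀ x → Dec (Q x)) → ∀ x → Q x →
        ∃[ m ] (Q m × (∀ j → j F.< m → ¬ Q j))
least {Q = Q} Q? x q = below (suc (toℕ x)) x ℕP.≤-refl q
  where
  below : ∀ bound x → toℕ x ℕ.< bound → Q x → ∃[ m ] (Q m × (∀ j → j F.< m → ¬ Q j))
  below (suc bound) x x<b q with FP.any? (λ j → (j FP.<? x) ×-dec Q? j)
  ... | no none = x , q , λ j j<x qj → none (j , j<x , qj)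
  ... | yes (j , j<x , qj) = below bound j (ℕP.<-≤-trans j<x (ℕP.≤-pred x<b)) qj

length-filter-split : ∀ {A : Set} {P : A → Set} (P? : ∀ x → Dec (P x)) xs →
  length (filter P? xs) + length (filter (¬? ∘ P?) xs) ≡ length xs
length-filter-split P? [] = refl
length-filter-split P? (x ∷ xs) with P? x
... | yes _ = cong suc (length-filter-split P? xs)
... | no _ = trans (ℕP.+-suc _ _) (cong suc (length-filter-split P? xs))

length-≤-injection : ∀ {A B : Set} (f : A → B) {xs : List A} {ys : List B} → Unique xs →
  (∀ {a b} → a ∈ xs → b ∈ xs → f a ≡ f b → a ≡ b) → (∀ {a} → a ∈ xs → f a ∈ ys) →
  length xs ≤ length ys
length-≤-injection f {[]} _ _ _ = z≤n
length-≤-injection f {x ∷ xs} {ys} (x∉xs ∷ unique) inj into with ∈-∃++ (into (here refl))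
... | us , vs , refl = begin
    suc (length xs)                ≤⟨ s≤s (length-≤-injection f unique (λ a b → inj (there a) (there b)) into′) ⟩
    suc (length (us ++ vs))        ≡⟨ cong suc (length-++ us) ⟩
    suc (length us + length vs)    ≡⟨ ℕP.+-suc (length us) (length vs) ⟨
    length us + length (f x ∷ vs)  ≡⟨ length-++ us ⟨
    length (us ++ f x ∷ vs)        ∎
  where
  open ℕP.≤-Reasoning
  into′ : ∀ {a} → a ∈ xs → f a ∈ us ++ vs
  into′ {a} a∈ with ∈-++⁻ us (into (there a∈))
  ... | inj₁ p = ∈-++⁺ˡ p
  ... | inj₂ (here fa≡fx) = ⊥-elim (All.lookup x∉xs a∈ (sym (inj (there a∈) (here refl) fa≡fx)))
  ... | inj₂ (there p) = ∈-++⁺ʳ us p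

star-comparable : ∀ {A : Set} {Q : A → A → Set} → (∀ {i j l} → Q i j → Q i l → j ≡ l) →
  ∀ {m x y} → Star Q m x → Star Q m y → Star Q x y ⊎ Star Q y x
star-comparable det ε q = inj₁ q
star-comparable det (r ◅ p) ε = inj₂ (r ◅ p)
star-comparable det (r ◅ p) (r′ ◅ q) with det r r′
... | refl = star-comparable det p q

e-diag : ∀ {n} (a : Fin n) → e a a ≡ 1ℤ
e-diag a with a FP.≟ a
... | yes _ = refl
... | no a≢a = ⊥-elim (a≢a refl)

e-offdiag : ∀ {n} {a x : Fin n} → a ≢ x → e a x ≡ 0ℤ
e-offdiag {a = a} {x} a≢x with a FP.≟ x
... | yes a≡x = ⊥-elim (a≢x a≡x)
... | no _ = refl

e-binary : ∀ {n} (a x : Fin n) → e a x ≡ 0ℤ ⊎ e a x ≡ 1ℤ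
e-binary a x with a FP.≟ x
... | yes _ = inj₂ refl
... | no _ = inj₁ refl

rootMultiple-support : ∀ {n} {v : Fin n → ℤ} {c a b} → (∀ x → v x ≡ c * eDiff a b x) →
  ∀ x → v x ≢ 0ℤ → x ≡ a ⊎ x ≡ b
rootMultiple-support {c = c} {a} {b} v≡ x vx≢0 with x FP.≟ a | x FP.≟ b
... | yes x≡a | _ = inj₁ x≡a
... | no _ | yes x≡b = inj₂ x≡b
... | no x≢a | no x≢b = ⊥-elim (vx≢0 (begin
    _                         ≡⟨ v≡ x ⟩
    c * (e a x - e b x)       ≡⟨ cong₂ (λ s t → c * (s - t)) (e-offdiag (x≢a ∘ sym)) (e-offdiag (x≢b ∘ sym)) ⟩
    c * 0ℤ                    ≡⟨ ℤP.*-zeroʳ c ⟩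
    0ℤ                        ∎))
  where open ≡-Reasoning

rootMultiple-support≤2 : ∀ {n} {v : Fin n → ℤ} → IsNonzeroMultipleOfRoot v →
  ∀ {x y z} → v x ≢ 0ℤ → v y ≢ 0ℤ → v z ≢ 0ℤ → x ≢ y → x ≢ z → y ≡ z
rootMultiple-support≤2 {v = v} (c , _ , a , b , _ , v≡) {x} {y} {z} vx vy vz =
  twoPoints (support x vx) (support y vy) (support z vz)
  where
  support : ∀ x → v x ≢ 0ℤ → x ≡ a ⊎ x ≡ b
  support = rootMultiple-support {c = c} v≡
  twoPoints : x ≡ a ⊎ x ≡ b → y ≡ a ⊎ y ≡ b → z ≡ a ⊎ z ≡ b → x ≢ y → x ≢ z → y ≡ z
  twoPoints (inj₁ refl) (inj₁ refl) _ x≢y _ = ⊥-elim (x≢y refl)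
  twoPoints (inj₂ refl) (inj₂ refl) _ x≢y _ = ⊥-elim (x≢y refl)
  twoPoints (inj₁ refl) (inj₂ refl) (inj₁ refl) _ x≢z = ⊥-elim (x≢z refl)
  twoPoints (inj₂ refl) (inj₁ refl) (inj₂ refl) _ x≢z = ⊥-elim (x≢z refl)
  twoPoints (inj₁ refl) (inj₂ refl) (inj₂ refl) _ _ = refl
  twoPoints (inj₂ refl) (inj₁ refl) (inj₁ refl) _ _ = refl

commonSource-rootMultiple : ∀ {n} {i j l : Fin n} → j ≢ l →
  IsNonzeroMultipleOfRoot (λ x → rootVec (i , j) x - rootVec (i , l) x)
commonSource-rootMultiple {i = i} {j} {l} j≢l =
  1ℤ , (λ ()) , l , j , j≢l ∘ sym , λ x → cancelSource (e i x) (e j x) (e l x)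
  where
  open +-*-Solver
  cancelSource : ∀ a b c → (a - b) - (a - c) ≡ 1ℤ * (c - b)
  cancelSource = solve 3 (λ a b c → (a :- b) :- (a :- c) := con 1ℤ :* (c :- b)) refl

commonTarget-rootMultiple : ∀ {n} {i j k : Fin n} → i ≢ k →
  IsNonzeroMultipleOfRoot (λ x → rootVec (i , j) x - rootVec (k , j) x)
commonTarget-rootMultiple {i = i} {j} {k} i≢k =
  1ℤ , (λ ()) , i , k , i≢k , λ x → cancelTarget (e i x) (e j x) (e k x)
  where
  open +-*-Solver
  cancelTarget : ∀ a b c → (a - b) - (c - b) ≡ 1ℤ * (a - c)
  cancelTarget = solve 3 (λ a b c → (a :- b) :- (c :- b) := con 1ℤ :* (a :- c)) refl

-- The values ±1 ± t (t ∈ {0,1}) taken by (e_i - e_j) - (e_k - e_l) at i, j, k, l.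
endpointValues-nonzero : ∀ {t} → t ≡ 0ℤ ⊎ t ≡ 1ℤ →
  (1ℤ - 0ℤ) - (0ℤ - t) ≢ 0ℤ × (0ℤ - 1ℤ) - (t - 0ℤ) ≢ 0ℤ ×
  (0ℤ - t) - (1ℤ - 0ℤ) ≢ 0ℤ × (t - 0ℤ) - (0ℤ - 1ℤ) ≢ 0ℤ
endpointValues-nonzero (inj₁ refl) = (λ ()) , (λ ()) , (λ ()) , (λ ())
endpointValues-nonzero (inj₂ refl) = (λ ()) , (λ ()) , (λ ()) , (λ ())

-- Positive roots with distinct sources and distinct targets never differ by a
-- multiple of a root: the difference is nonzero at i, j, k, l, so j = k and
-- l = i, contradicting i < j = k < l = i.
disjointEnds-notRootMultiple : ∀ {n} {i j k l : Fin n} → i F.< j → k F.< l → i ≢ k → j ≢ l →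
  ¬ IsNonzeroMultipleOfRoot (λ x → rootVec (i , j) x - rootVec (k , l) x)
disjointEnds-notRootMultiple {n} {i} {j} {k} {l} i<j k<l i≢k j≢l multiple =
  FP.<-irrefl refl (FP.<-trans i<j (subst₂ F._<_ (sym j≡k) l≡i k<l))
  where
  i≢j : i ≢ j
  i≢j = FP.<⇒≢ i<j
  k≢l : k ≢ l
  k≢l = FP.<⇒≢ k<l
  v : Fin n → ℤ
  v x = rootVec (i , j) x - rootVec (k , l) x
  v-i : v i ≢ 0ℤ
  v-i rewrite e-diag i | e-offdiag (i≢j ∘ sym) | e-offdiag (i≢k ∘ sym) =
    proj₁ (endpointValues-nonzero (e-binary l i))
  v-j : v j ≢ 0ℤ
  v-j rewrite e-diag j | e-offdiag i≢j | e-offdiag (j≢l ∘ sym) =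
    proj₁ (proj₂ (endpointValues-nonzero (e-binary k j)))
  v-k : v k ≢ 0ℤ
  v-k rewrite e-diag k | e-offdiag i≢k | e-offdiag (k≢l ∘ sym) =
    proj₁ (proj₂ (proj₂ (endpointValues-nonzero (e-binary j k))))
  v-l : v l ≢ 0ℤ
  v-l rewrite e-diag l | e-offdiag j≢l | e-offdiag k≢l =
    proj₂ (proj₂ (proj₂ (endpointValues-nonzero (e-binary i l))))
  j≡k : j ≡ k
  j≡k = rootMultiple-support≤2 multiple v-i v-j v-k i≢j i≢k
  l≡i : l ≡ i
  l≡i = rootMultiple-support≤2 multiple v-k v-l v-i k≢l (i≢k ∘ sym)

OutDegree≤1 : ∀ {n} → List (Fin n × Fin n) → Set
OutDegree≤1 L = ∀ {i j l} → (i , j) ∈ L → (i , l) ∈ L → j ≡ l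

InDegree≤1 : ∀ {n} → List (Fin n × Fin n) → Set
InDegree≤1 L = ∀ {i j k} → (i , j) ∈ L → (k , j) ∈ L → i ≡ k

quasiAntichain⇒outDegree≤1 : ∀ {n} {L : List (Fin n × Fin n)} → IsQuasiAntichain L → OutDegree≤1 L
quasiAntichain⇒outDegree≤1 qa {i} {j} {l} ij∈ il∈ with j FP.≟ l
... | yes j≡l = j≡l
... | no j≢l = ⊥-elim (qa ij∈ il∈ (j≢l ∘ cong proj₂) (commonSource-rootMultiple {i = i} j≢l))

quasiAntichain⇒inDegree≤1 : ∀ {n} {L : List (Fin n × Fin n)} → IsQuasiAntichain L → InDegree≤1 L
quasiAntichain⇒inDegree≤1 qa {i} {k = k} ij∈ kj∈ with i FP.≟ k
... | yes i≡k = i≡k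
... | no i≢k = ⊥-elim (qa ij∈ kj∈ (i≢k ∘ cong proj₁) (commonTarget-rootMultiple i≢k))

partialInjection⇒quasiAntichain : ∀ {n} {L : List (Fin n × Fin n)} → All IsPositive L →
  OutDegree≤1 L → InDegree≤1 L → IsQuasiAntichain L
partialInjection⇒quasiAntichain positive out≤1 in≤1 {i , j} {k , l} α∈ β∈ α≢β =
  disjointEnds-notRootMultiple (All.lookup positive α∈) (All.lookup positive β∈) i≢k j≢l
  where
  i≢k : i ≢ k
  i≢k refl = α≢β (cong (i ,_) (out≤1 α∈ β∈))
  j≢l : j ≢ l
  j≢l refl = α≢β (cong (_, j) (in≤1 α∈ β∈))

module Chains {n : ℕ} (L : List (Fin n × Fin n)) (unique : Unique L)
  (increasing : All IsPositive L) (out≤1 : OutDegree≤1 L) (in≤1 : InDegree≤1 L) where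

  Arc : Fin n → Fin n → Set
  Arc i j = (i , j) ∈ L

  Arc? : ∀ i j → Dec (Arc i j)
  Arc? i j = DecMembership._∈?_ (ProductP.≡-dec FP._≟_ FP._≟_) (i , j) L

  arc-< : ∀ {i j} → Arc i j → i F.< j
  arc-< = All.lookup increasing

  Chain : Fin n → Fin n → Set
  Chain = Star Arc

  chain-≤ : ∀ {a b} → Chain a b → toℕ a ≤ toℕ b
  chain-≤ ε = ℕP.≤-refl
  chain-≤ (r ◅ p) = ℕP.≤-trans (ℕP.<⇒≤ (arc-< r)) (chain-≤ p)

  chain-antisym : ∀ {a b} → Chain a b → Chain b a → a ≡ b
  chain-antisym p q = FP.toℕ-injective (ℕP.≤-antisym (chain-≤ p) (chain-≤ q))

  chain-first : ∀ {a b} → Chain a b → a ≢ b → ∃[ c ] (Arc a c × Chain c b)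
  chain-first ε a≢b = ⊥-elim (a≢b refl)
  chain-first (r ◅ p) _ = _ , r , p

  chain-< : ∀ {a b} → Chain a b → a ≢ b → toℕ a ℕ.< toℕ b
  chain-< p a≢b with chain-first p a≢b
  ... | _ , r , q = ℕP.<-≤-trans (arc-< r) (chain-≤ q)

  chain-last : ∀ {a b} → Chain a b → a ≢ b → ∃[ c ] (Chain a c × Arc c b)
  chain-last ε a≢b = ⊥-elim (a≢b refl)
  chain-last {a} {b} (_◅_ {j = c} r p) _ with c FP.≟ b
  ... | yes refl = a , ε , r
  ... | no c≢b with chain-last p c≢b
  ...   | d , q , r′ = d , r ◅ q , r′

  arc-functional : ∀ {i j l} → Arc i j → Arc i l → j ≡ l
  arc-functional = out≤1

  chain-comparable : ∀ {m x y} → Chain m x → Chain m y → Chain x y ⊎ Chain y x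
  chain-comparable = star-comparable out≤1

  chain-comparableᴿ : ∀ {x y m} → Chain x m → Chain y m → Chain x y ⊎ Chain y x
  chain-comparableᴿ p q with star-comparable {Q = flip Arc} in≤1 (reverse (λ r → r) p) (reverse (λ r → r) q)
  ... | inj₁ s = inj₂ (reverse (λ r → r) s)
  ... | inj₂ s = inj₁ (reverse (λ r → r) s)

  Source : Fin n → Set
  Source m = ¬ (∃[ i ] Arc i m)

  Source? : ∀ m → Dec (Source m)
  Source? m = ¬? (FP.any? (λ i → Arc? i m))

  source-chain-end : ∀ {a b} → Source b → Chain a b → a ≡ b
  source-chain-end {a} {b} b-source p with a FP.≟ b
  ... | yes a≡b = a≡b
  ... | no a≢b with chain-last p a≢b
  ...   | c , _ , r = ⊥-elim (b-source (c , r))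

  -- Reachability is decidable: walk backwards along the unique incoming arcs.
  chain? : ∀ m y → Dec (Chain m y)
  chain? m y = walk (suc (toℕ y)) y ℕP.≤-refl
    where
    walk : ∀ bound y → toℕ y ℕ.< bound → Dec (Chain m y)
    walk (suc bound) y y<b with m FP.≟ y
    ... | yes refl = yes ε
    ... | no m≢y with FP.any? (λ i → Arc? i y)
    ...   | no none = no λ p → none (proj₁ (chain-last p m≢y) , proj₂ (proj₂ (chain-last p m≢y)))
    ...   | yes (p , p→y) with walk bound p (ℕP.<-≤-trans (arc-< p→y) (ℕP.≤-pred y<b))
    ...     | yes q = yes (q ◅◅ (p→y ◅ ε))
    ...     | no ¬q = no λ q → let c , q′ , c→y = chain-last q m≢y in
                               ¬q (subst (Chain m) (in≤1 c→y p→y) q′)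

  source-above : ∀ x → ∃[ m ] (Source m × Chain m x)
  source-above x = climb (suc (toℕ x)) x ℕP.≤-refl
    where
    climb : ∀ bound x → toℕ x ℕ.< bound → ∃[ m ] (Source m × Chain m x)
    climb (suc bound) x x<b with FP.any? (λ i → Arc? i x)
    ... | no none = x , none , ε
    ... | yes (p , p→x) with climb bound p (ℕP.<-≤-trans (arc-< p→x) (ℕP.≤-pred x<b))
    ...   | m , m-source , q = m , m-source , q ◅◅ (p→x ◅ ε)

  chainFrom : Fin n → Subset n
  chainFrom m = subsetOf (chain? m)

  chainFrom-injective : ∀ {a b} → chainFrom a ≡ chainFrom b → a ≡ b
  chainFrom-injective {a} {b} eq = chain-antisym
    (∈-subsetOf⁻ (chain? a) (subst (b ∈ₛ_) (sym eq) (∈-subsetOf⁺ (chain? b) ε)))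
    (∈-subsetOf⁻ (chain? b) (subst (a ∈ₛ_) eq (∈-subsetOf⁺ (chain? a) ε)))

  sources : List (Fin n)
  sources = filter Source? (allFin n)

  chainBlocks : List (Subset n)
  chainBlocks = map chainFrom sources

  ∈-chainBlocks⁻ : ∀ {B} → B ∈ chainBlocks → ∃[ m ] (Source m × B ≡ chainFrom m)
  ∈-chainBlocks⁻ B∈ with ∈-map⁻ chainFrom B∈
  ... | m , m∈ , refl = m , proj₂ (∈-filter⁻ Source? {xs = allFin n} m∈) , refl

  ∈-chainBlocks⁺ : ∀ {m} → Source m → chainFrom m ∈ chainBlocks
  ∈-chainBlocks⁺ {m} m-source = ∈-map⁺ chainFrom (∈-filter⁺ Source? (∈-allFin m) m-source)

  chainBlocks-partition : IsSetPartition chainBlocks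
  chainBlocks-partition =
    UniqueP.map⁺ chainFrom-injective (UniqueP.filter⁺ Source? (UniqueP.allFin⁺ n)) ,
    All.tabulate nonempty , disjoint , covering
    where
    nonempty : ∀ {B} → B ∈ chainBlocks → Nonempty B
    nonempty B∈ with ∈-chainBlocks⁻ B∈
    ... | m , _ , refl = m , ∈-subsetOf⁺ (chain? m) ε
    -- a common point makes the two sources comparable, hence equal
    disjoint : ∀ {B B′} → B ∈ chainBlocks → B′ ∈ chainBlocks → B ≢ B′ → Empty (B ∩ B′)
    disjoint B∈ B′∈ B≢B′ (x , x∈B∩B′) with ∈-chainBlocks⁻ B∈ | ∈-chainBlocks⁻ B′∈ | SubsetP.x∈p∩q⁻ _ _ x∈B∩B′
    ... | m , m-source , refl | m′ , m′-source , refl | x∈B , x∈B′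
      with chain-comparableᴿ (∈-subsetOf⁻ (chain? m) x∈B) (∈-subsetOf⁻ (chain? m′) x∈B′)
    ...   | inj₁ p = B≢B′ (cong chainFrom (source-chain-end m′-source p))
    ...   | inj₂ p = B≢B′ (cong chainFrom (sym (source-chain-end m-source p)))
    covering : ∀ x → ∃[ B ] (B ∈ chainBlocks × x ∈ₛ B)
    covering x with source-above x
    ... | m , m-source , p = chainFrom m , ∈-chainBlocks⁺ m-source , ∈-subsetOf⁺ (chain? m) p

  commonBlock⁻ : ∀ {B x y} → B ∈ chainBlocks → x ∈ₛ B → y ∈ₛ B →
    ∃[ m ] (Source m × Chain m x × Chain m y)
  commonBlock⁻ B∈ x∈ y∈ with ∈-chainBlocks⁻ B∈
  ... | m , m-source , refl = m , m-source , ∈-subsetOf⁻ (chain? m) x∈ , ∈-subsetOf⁻ (chain? m) y∈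

  commonBlock⁺ : ∀ {m x y} → Source m → Chain m x → Chain m y →
    ∃[ B ] (B ∈ chainBlocks × x ∈ₛ B × y ∈ₛ B)
  commonBlock⁺ {m} m-source p q =
    chainFrom m , ∈-chainBlocks⁺ m-source , ∈-subsetOf⁺ (chain? m) p , ∈-subsetOf⁺ (chain? m) q

  -- The non-sources are exactly the targets of arcs, one per arc.
  targets : List (Fin n)
  targets = filter (¬? ∘ Source?) (allFin n)

  targets-count : length targets ≡ length L
  targets-count = ℕP.≤-antisym targets≤arcs arcs≤targets
    where
    arcs≤targets : length L ≤ length targets
    arcs≤targets = length-≤-injection proj₂ unique
      (λ { {i , j} {k , l} α∈ β∈ refl → cong (_, j) (in≤1 α∈ β∈) })
      (λ { {i , j} α∈ → ∈-filter⁺ (¬? ∘ Source?) (∈-allFin j) (λ j-source → j-source (i , α∈)) })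
    target-has-arc : ∀ {m} → m ∈ targets → m ∈ map proj₂ L
    target-has-arc {m} m∈ with FP.any? (λ i → Arc? i m)
    ... | yes (i , α∈) = ∈-map⁺ proj₂ α∈
    ... | no none = ⊥-elim (proj₂ (∈-filter⁻ (¬? ∘ Source?) {xs = allFin n} m∈) none)
    targets≤arcs : length targets ≤ length L
    targets≤arcs = ℕP.≤-trans
      (length-≤-injection (λ x → x) (UniqueP.filter⁺ (¬? ∘ Source?) (UniqueP.allFin⁺ n)) (λ _ _ eq → eq) target-has-arc)
      (ℕP.≤-reflexive (length-map proj₂ L))

  chainBlocks-count : length chainBlocks ≡ n ∸ length L
  chainBlocks-count = begin
    length (map chainFrom sources)              ≡⟨ length-map chainFrom sources ⟩
    length sources                              ≡⟨ ℕP.m+n∸n≡m (length sources) (length L) ⟨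
    length sources + length L ∸ length L        ≡⟨ cong (λ t → length sources + t ∸ length L) targets-count ⟨
    length sources + length targets ∸ length L  ≡⟨ cong (_∸ length L) sources+targets ⟩
    n ∸ length L                                ∎
    where
    open ≡-Reasoning
    sources+targets : length sources + length targets ≡ n
    sources+targets = trans (length-filter-split Source? (allFin n)) (length-tabulate (λ i → i))

module ChainsOf {n : ℕ} (S : QuasiAntichain n) = Chains (proj₁ S) (proj₁ (proj₂ S))
  (proj₁ (proj₂ (proj₂ S))) (quasiAntichain⇒outDegree≤1 (proj₂ (proj₂ (proj₂ S))))
  (quasiAntichain⇒inDegree≤1 (proj₂ (proj₂ (proj₂ S))))

toPartition : ∀ {n} → QuasiAntichain n → SetPartition n
toPartition S = ChainsOf.chainBlocks S , ChainsOf.chainBlocks-partition S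

NextIn : ∀ {n} → (Fin n → Fin n → Set) → Fin n → Fin n → Set
NextIn R i j = i F.< j × R i j × (∀ m → i F.< m → m F.< j → ¬ R i m)

nextIn-transport : ∀ {n} {R₁ R₂ : Fin n → Fin n → Set} →
  (∀ {x y} → R₁ x y → R₂ x y) → (∀ {x y} → R₂ x y → R₁ x y) → ∀ {i j} → NextIn R₁ i j → NextIn R₂ i j
nextIn-transport to from (i<j , ij , j-next) = i<j , to ij , λ m i<m m<j im → j-next m i<m m<j (from im)

module Consecutive {n : ℕ} (bs : List (Subset n)) (isPartition : IsSetPartition bs) where

  SameBlock : Fin n → Fin n → Set
  SameBlock x y = ∃[ B ] (B ∈ bs × x ∈ₛ B × y ∈ₛ B)

  sameBlock? : ∀ x y → Dec (SameBlock x y)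
  sameBlock? x y = map′ find (λ (_ , B∈ , xy∈) → lose B∈ xy∈)
    (Any.any? (λ B → (x SubsetP.∈? B) ×-dec (y SubsetP.∈? B)) bs)

  block-unique : ∀ {B B′ x} → B ∈ bs → B′ ∈ bs → x ∈ₛ B → x ∈ₛ B′ → B ≡ B′
  block-unique {B} {B′} B∈ B′∈ x∈B x∈B′ with VecP.≡-dec BoolP._≟_ B B′
  ... | yes B≡B′ = B≡B′
  ... | no B≢B′ = ⊥-elim (proj₁ (proj₂ (proj₂ isPartition)) B∈ B′∈ B≢B′ (_ , SubsetP.x∈p∩q⁺ (x∈B , x∈B′)))

  sameBlock-refl : ∀ x → SameBlock x x
  sameBlock-refl x with proj₂ (proj₂ (proj₂ isPartition)) x
  ... | B , B∈ , x∈B = B , B∈ , x∈B , x∈B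

  sameBlock-sym : ∀ {x y} → SameBlock x y → SameBlock y x
  sameBlock-sym (B , B∈ , x∈ , y∈) = B , B∈ , y∈ , x∈

  sameBlock-trans : ∀ {x y z} → SameBlock x y → SameBlock y z → SameBlock x z
  sameBlock-trans (B , B∈ , x∈ , y∈) (B′ , B′∈ , y∈′ , z∈) with block-unique B∈ B′∈ y∈ y∈′
  ... | refl = B , B∈ , x∈ , z∈

  Next : Fin n → Fin n → Set
  Next = NextIn SameBlock

  Next? : ∀ i j → Dec (Next i j)
  Next? i j = (i FP.<? j) ×-dec (sameBlock? i j ×-dec
    FP.all? (λ m → (i FP.<? m) →-dec ((m FP.<? j) →-dec ¬? (sameBlock? i m))))

  next-functional : ∀ {i j l} → Next i j → Next i l → j ≡ l
  next-functional {j = j} {l} (i<j , ij , j-first) (i<l , il , l-first) with FP.<-cmp j l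
  ... | tri< j<l _ _ = ⊥-elim (l-first j i<j j<l ij)
  ... | tri≈ _ j≡l _ = j≡l
  ... | tri> _ _ l<j = ⊥-elim (j-first l i<l l<j il)

  next-injective : ∀ {i j k} → Next i j → Next k j → i ≡ k
  next-injective {i} {k = k} (i<j , ij , i-last) (k<j , kj , k-last) with FP.<-cmp i k
  ... | tri< i<k _ _ = ⊥-elim (i-last k i<k k<j (sameBlock-trans ij (sameBlock-sym kj)))
  ... | tri≈ _ i≡k _ = i≡k
  ... | tri> _ _ k<i = ⊥-elim (k-last i k<i i<j (sameBlock-trans kj (sameBlock-sym ij)))

  NextPair? : ∀ (p : Fin n × Fin n) → Dec (Next (proj₁ p) (proj₂ p))
  NextPair? (i , j) = Next? i j

  allPairs : List (Fin n × Fin n)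
  allPairs = cartesianProduct (allFin n) (allFin n)

  arcs : List (Fin n × Fin n)
  arcs = filter NextPair? allPairs

  ∈-arcs⁻ : ∀ {i j} → (i , j) ∈ arcs → Next i j
  ∈-arcs⁻ α∈ = proj₂ (∈-filter⁻ NextPair? {xs = allPairs} α∈)

  ∈-arcs⁺ : ∀ {i j} → Next i j → (i , j) ∈ arcs
  ∈-arcs⁺ {i} {j} next = ∈-filter⁺ NextPair? (∈-cartesianProduct⁺ (∈-allFin i) (∈-allFin j)) next

  arcs-increasing : All IsPositive arcs
  arcs-increasing = All.tabulate (λ { {i , j} α∈ → proj₁ (∈-arcs⁻ α∈) })

  toQuasiAntichain : QuasiAntichain n
  toQuasiAntichain =
    arcs ,
    UniqueP.filter⁺ NextPair? (UniqueP.cartesianProduct⁺ (UniqueP.allFin⁺ n) (UniqueP.allFin⁺ n)) ,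
    arcs-increasing ,
    partialInjection⇒quasiAntichain arcs-increasing
      (λ α∈ β∈ → next-functional (∈-arcs⁻ α∈) (∈-arcs⁻ β∈))
      (λ α∈ β∈ → next-injective (∈-arcs⁻ α∈) (∈-arcs⁻ β∈))

  open module C = ChainsOf toQuasiAntichain using (Chain; Source; chain?; chainFrom; chainBlocks)

  chain⇒sameBlock : ∀ {m y} → Chain m y → SameBlock m y
  chain⇒sameBlock {m} ε = sameBlock-refl m
  chain⇒sameBlock (α∈ ◅ p) = sameBlock-trans (proj₁ (proj₂ (∈-arcs⁻ α∈))) (chain⇒sameBlock p)

  -- Conversely, the later elements of a block are reached by stepping to the
  -- least later element of the block, repeatedly.
  sameBlock⇒chain : ∀ {m y} → SameBlock m y → toℕ m ≤ toℕ y → Chain m y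
  sameBlock⇒chain {m} {y} my m≤y =
    gmap (λ x → x) ∈-arcs⁺ (steps (suc (toℕ y)) m my m≤y (s≤s (ℕP.m≤m+n (toℕ y) (toℕ m))))
    where
    steps : ∀ bound m → SameBlock m y → toℕ m ≤ toℕ y → toℕ y ℕ.< bound + toℕ m → Star Next m y
    steps zero m _ m≤y y<b = ⊥-elim (ℕP.<⇒≱ y<b m≤y)
    steps (suc bound) m my m≤y y<b with m FP.≟ y
    ... | yes refl = ε
    ... | no m≢y with least (λ c → (m FP.<? c) ×-dec sameBlock? m c) y (FP.≤∧≢⇒< m≤y m≢y , my)
    ...   | c , (m<c , mc) , c-least = m→c ◅ steps bound c cy c≤y y<b′
      where
      m→c : Next m c
      m→c = m<c , mc , λ m′ m<m′ m′<c mm′ → c-least m′ m′<c (m<m′ , mm′)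
      cy : SameBlock c y
      cy = sameBlock-trans (sameBlock-sym mc) my
      c≤y : toℕ c ≤ toℕ y
      c≤y = ℕP.≮⇒≥ (λ y<c → c-least y y<c (FP.≤∧≢⇒< m≤y m≢y , my))
      y<b′ : toℕ y ℕ.< bound + toℕ c
      y<b′ = ℕP.<-≤-trans y<b (subst (ℕ._≤ bound + toℕ c) (ℕP.+-suc bound (toℕ m)) (ℕP.+-monoʳ-≤ bound m<c))

  chainFrom-block : ∀ {m B} → Source m → B ∈ bs → m ∈ₛ B → chainFrom m ≡ B
  chainFrom-block {m} {B} m-source B∈ m∈B = SubsetP.⊆-antisym chain⊆B B⊆chain
    where
    chain⊆B : ∀ {y} → y ∈ₛ chainFrom m → y ∈ₛ B
    chain⊆B {y} y∈ with chain⇒sameBlock (∈-subsetOf⁻ (chain? m) y∈)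
    ... | B′ , B′∈ , m∈B′ , y∈B′ = subst (y ∈ₛ_) (block-unique B′∈ B∈ m∈B′ m∈B) y∈B′
    source-least : ∀ {y} → SameBlock m y → toℕ m ≤ toℕ y
    source-least my = ℕP.≮⇒≥ (λ y<m →
      FP.<⇒≢ y<m (C.source-chain-end m-source (sameBlock⇒chain (sameBlock-sym my) (ℕP.<⇒≤ y<m))))
    B⊆chain : ∀ {y} → y ∈ₛ B → y ∈ₛ chainFrom m
    B⊆chain {y} y∈ = ∈-subsetOf⁺ (chain? m) (sameBlock⇒chain my (source-least my))
      where
      my : SameBlock m y
      my = B , B∈ , m∈B , y∈

  chainBlocks-roundTrip : SameElems chainBlocks bs
  chainBlocks-roundTrip B = chainBlock⇒block , block⇒chainBlock
    where
    chainBlock⇒block : B ∈ chainBlocks → B ∈ bs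
    chainBlock⇒block B∈ with C.∈-chainBlocks⁻ B∈
    ... | m , m-source , refl with proj₂ (proj₂ (proj₂ isPartition)) m
    ...   | B₀ , B₀∈ , m∈B₀ = subst (_∈ bs) (sym (chainFrom-block m-source B₀∈ m∈B₀)) B₀∈
    -- the least element of a block has no predecessor, so it is a source
    block⇒chainBlock : B ∈ bs → B ∈ chainBlocks
    block⇒chainBlock B∈ with All.lookup (proj₁ (proj₂ isPartition)) B∈
    ... | x , x∈ with least (λ y → y SubsetP.∈? B) x x∈
    ...   | m , m∈B , m-least = subst (_∈ chainBlocks) (chainFrom-block m-source B∈ m∈B) (C.∈-chainBlocks⁺ m-source)
      where
      m-source : Source m
      m-source (i , α∈) with ∈-arcs⁻ α∈
      ... | i<m , (B′ , B′∈ , i∈B′ , m∈B′) , _ = m-least i i<m (subst (i ∈ₛ_) (block-unique B′∈ B∈ m∈B′ m∈B) i∈B′)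

toQuasiAntichain : ∀ {n} → SetPartition n → QuasiAntichain n
toQuasiAntichain P = Consecutive.toQuasiAntichain (proj₁ P) (proj₂ P)

-- The consecutive-element arcs of the chain partition of S are the arcs of S:
-- within a chain, consecutive block elements are exactly the arc endpoints.
arcs-roundTrip : ∀ {n} (S : QuasiAntichain n) → SameElems (proj₁ (toQuasiAntichain (toPartition S))) (proj₁ S)
arcs-roundTrip {n} S (i , j) = next⇒arc , arc⇒next
  where
  module A = ChainsOf S
  module P = Consecutive A.chainBlocks A.chainBlocks-partition
  next⇒arc : (i , j) ∈ P.arcs → (i , j) ∈ proj₁ S
  next⇒arc α∈ with P.∈-arcs⁻ α∈
  ... | i<j , (B , B∈ , i∈ , j∈) , j-next with A.commonBlock⁻ B∈ i∈ j∈
  ...   | m , m-source , m⇝i , m⇝j with A.chain-comparable m⇝i m⇝j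
  ...     | inj₂ j⇝i = ⊥-elim (ℕP.<⇒≱ i<j (A.chain-≤ j⇝i))
  ...     | inj₁ i⇝j with A.chain-first i⇝j (FP.<⇒≢ i<j)
  ...       | c , i→c , c⇝j with c FP.≟ j
  ...         | yes refl = i→c
  ...         | no c≢j = ⊥-elim (j-next c (A.arc-< i→c) (A.chain-< c⇝j c≢j)
                                 (A.commonBlock⁺ m-source m⇝i (m⇝i ◅◅ (i→c ◅ ε))))
  arc⇒next : (i , j) ∈ proj₁ S → (i , j) ∈ P.arcs
  arc⇒next i→j with A.source-above i
  ... | m , m-source , m⇝i = P.∈-arcs⁺ (A.arc-< i→j , A.commonBlock⁺ m-source m⇝i (m⇝i ◅◅ (i→j ◅ ε)) , j-next)
    where
    -- anything after i in its block is reached through the arc i → j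
    j-next : ∀ m′ → i F.< m′ → m′ F.< j → ¬ P.SameBlock i m′
    j-next m′ i<m′ m′<j (B , B∈ , i∈ , m′∈) with A.commonBlock⁻ B∈ i∈ m′∈
    ... | m₀ , _ , m₀⇝i , m₀⇝m′ with A.chain-comparable m₀⇝i m₀⇝m′
    ...   | inj₂ m′⇝i = ℕP.<⇒≱ i<m′ (A.chain-≤ m′⇝i)
    ...   | inj₁ i⇝m′ with A.chain-first i⇝m′ (FP.<⇒≢ i<m′)
    ...     | c , i→c , c⇝m′ with A.arc-functional i→j i→c
    ...       | refl = ℕP.<⇒≱ m′<j (A.chain-≤ c⇝m′)

toPartition-cong : ∀ {n} (S T : QuasiAntichain n) → SameElems (proj₁ S) (proj₁ T) →
  proj₁ (toPartition S) ≡ proj₁ (toPartition T)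
toPartition-cong {n} S T S≈T =
  trans (cong (map A.chainFrom) same-sources) (map-cong same-chains B.sources)
  where
  module A = ChainsOf S
  module B = ChainsOf T
  S⊆T : ∀ {i j} → A.Arc i j → B.Arc i j
  S⊆T {i} {j} = proj₁ (S≈T (i , j))
  T⊆S : ∀ {i j} → B.Arc i j → A.Arc i j
  T⊆S {i} {j} = proj₂ (S≈T (i , j))
  same-sources : A.sources ≡ B.sources
  same-sources = filter-≐ A.Source? B.Source?
    ((λ m-source (i , α∈) → m-source (i , T⊆S α∈)) , (λ m-source (i , α∈) → m-source (i , S⊆T α∈)))
    (allFin n)
  same-chains : ∀ m → A.chainFrom m ≡ B.chainFrom m
  same-chains m = SubsetP.⊆-antisym
    (∈-subsetOf⁺ (B.chain? m) ∘ gmap (λ x → x) S⊆T ∘ ∈-subsetOf⁻ (A.chain? m))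
    (∈-subsetOf⁺ (A.chain? m) ∘ gmap (λ x → x) T⊆S ∘ ∈-subsetOf⁻ (B.chain? m))

toQuasiAntichain-cong : ∀ {n} (P Q : SetPartition n) → SameElems (proj₁ P) (proj₁ Q) →
  proj₁ (toQuasiAntichain P) ≡ proj₁ (toQuasiAntichain Q)
toQuasiAntichain-cong {n} P Q P≈Q =
  filter-≐ A.NextPair? B.NextPair?
    (nextIn-transport {R₁ = A.SameBlock} {B.SameBlock} A⇒B B⇒A ,
     nextIn-transport {R₁ = B.SameBlock} {A.SameBlock} B⇒A A⇒B) A.allPairs
  where
  module A = Consecutive (proj₁ P) (proj₂ P)
  module B = Consecutive (proj₁ Q) (proj₂ Q)
  A⇒B : ∀ {x y} → A.SameBlock x y → B.SameBlock x y
  A⇒B (C , C∈ , x∈ , y∈) = C , proj₁ (P≈Q C) C∈ , x∈ , y∈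
  B⇒A : ∀ {x y} → B.SameBlock x y → A.SameBlock x y
  B⇒A (C , C∈ , x∈ , y∈) = C , proj₂ (P≈Q C) C∈ , x∈ , y∈

≡⇒sameElems : ∀ {A : Set} {xs ys : List A} → xs ≡ ys → SameElems xs ys
≡⇒sameElems refl x = (λ x∈ → x∈) , (λ x∈ → x∈)

toPartition-injective : ∀ {n} {S T : QuasiAntichain n} →
  SameElems (proj₁ (toPartition S)) (proj₁ (toPartition T)) → SameElems (proj₁ S) (proj₁ T)
toPartition-injective {n} {S} {T} eq = begin
  S                                 ≈⟨ arcs-roundTrip S ⟨
  toQuasiAntichain (toPartition S)  ≈⟨ ≡⇒sameElems (toQuasiAntichain-cong (toPartition S) (toPartition T) eq) ⟩
  toQuasiAntichain (toPartition T)  ≈⟨ arcs-roundTrip T ⟩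
  T                                 ∎
  where open SetoidReasoning (QuasiAntichainSetoid n)

toPartition-surjective : ∀ {n} (P : SetPartition n) {S : QuasiAntichain n} →
  SameElems (proj₁ S) (proj₁ (toQuasiAntichain P)) → SameElems (proj₁ (toPartition S)) (proj₁ P)
toPartition-surjective {n} P {S} eq = begin
  toPartition S                     ≈⟨ ≡⇒sameElems (toPartition-cong S (toQuasiAntichain P) eq) ⟩
  toPartition (toQuasiAntichain P)  ≈⟨ Consecutive.chainBlocks-roundTrip (proj₁ P) (proj₂ P) ⟩
  P                                 ∎
  where open SetoidReasoning (SetPartitionSetoid n)

lemma4p1 : (n : ℕ) → 2 ≤ n →
    Σ (Bijection (QuasiAntichainSetoid n) (SetPartitionSetoid n)) λ f →
    ∀ (S : QuasiAntichain n) (k : ℕ) → k ≤ n → card S ≡ n ∸ k →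
    blocks (Bijection.to f S) ≡ k
lemma4p1 n _ = bijection , blockCount
  where
  bijection : Bijection (QuasiAntichainSetoid n) (SetPartitionSetoid n)
  bijection = record
    { to = toPartition
    ; cong = λ {S} {T} eq → ≡⇒sameElems (toPartition-cong S T eq)
    ; bijective = (λ {S} {T} → toPartition-injective {n} {S} {T})
                , (λ P → toQuasiAntichain P , λ {S} → toPartition-surjective P {S})
    }
  blockCount : ∀ (S : QuasiAntichain n) (k : ℕ) → k ≤ n → card S ≡ n ∸ k → blocks (toPartition S) ≡ k
  blockCount S k k≤n card≡ = begin
    blocks (toPartition S) ≡⟨ ChainsOf.chainBlocks-count S ⟩
    n ∸ card S             ≡⟨ cong (n ∸_) card≡ ⟩
    n ∸ (n ∸ k)            ≡⟨ ℕP.m∸[m∸n]≡n k≤n ⟩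
    k                      ∎
    where open ≡-Reasoning
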